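{- Let $q(x)\in\mathbb{Q}[x]$ be a polynomial of degree $d\ge1$ with non-constant term. For integers $m\ge0$, $r\ge0$ and $n\ge1$, \[ \Sigma^r q(n)^m=\sum_{j=0}^m(-1)^j\binom{2m+1}{j}\,\Sigma^r C^P_{(m-j)\,q(n)}. \]
   Context: For integers $n,k\ge0$ let $T_k(n)=\binom{n+k+1}{2k+1}+\binom{n+k}{2k+1}$ and $P_n(x)=\sum_{k=0}^n T_k(n)x^k$. For a polynomial $q$ and integer $m\ge0$ define $\Sigma^0 q(n)^m=q(n)^m$ and $\Sigma^{r+1}q(n)^m=\Sigma^r q(1)^m+\Sigma^r q(2)^m+\cdots+\Sigma^r q(n)^m$; similarly $\Sigma^0 C^P_{m\,q(n)}=P_m(q(n))$ and $\Sigma^{r+1}C^P_{m\,q(n)}=\Sigma^r C^P_{m\,q(1)}+\Sigma^r C^P_{m\,q(2)}+\cdots+\Sigma^r C^P_{m\,q(n)}$. -}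

module Defs where

open import Data.Nat as ℕ using (ℕ; zero; suc; _∸_; _≤_)
open import Data.Nat.Combinatorics using (_C_)
open import Data.Integer using (+_)
open import Data.Rational using (ℚ; 0ℚ; 1ℚ; _+_; _*_; -_; _/_)
open import Data.List using (List; []; _∷_; _++_; length)
open import Data.Product using (Σ; _×_)
open import Relation.Binary.PropositionalEquality using (_≡_; _≢_)

ℕ→ℚ : ℕ → ℚ
ℕ→ℚ n = (+ n) / 1

_^ℚ_ : ℚ → ℕ → ℚ
x ^ℚ zero  = 1ℚ
x ^ℚ suc m = x * (x ^ℚ m)

sgn : ℕ → ℚ
sgn zero    = 1ℚ
sgn (suc j) = - sgn j

sum0 : (ℕ → ℚ) → ℕ → ℚ
sum0 f zero    = f 0
sum0 f (suc n) = sum0 f n + f (suc n)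

sum1 : (ℕ → ℚ) → ℕ → ℚ
sum1 f zero    = 0ℚ
sum1 f (suc n) = sum1 f n + f (suc n)

T : ℕ → ℕ → ℕ
T k n = ((n ℕ.+ k ℕ.+ 1) C (2 ℕ.* k ℕ.+ 1)) ℕ.+ ((n ℕ.+ k) C (2 ℕ.* k ℕ.+ 1))

P : ℕ → ℚ → ℚ
P n x = sum0 (λ k → ℕ→ℚ (T k n) * (x ^ℚ k)) n

-- polynomials over ℚ as coefficient lists, lowest degree first
Poly : Set
Poly = List ℚ

eval : Poly → ℚ → ℚ
eval []       x = 0ℚ
eval (c ∷ cs) x = c + x * eval cs x

HasDegree : Poly → ℕ → Set
HasDegree q d = Σ (List ℚ) λ cs → Σ ℚ λ a → (q ≡ cs ++ (a ∷ [])) × (a ≢ 0ℚ) × (length cs ≡ d)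

Σⁱ : ℕ → (ℕ → ℚ) → ℕ → ℚ
Σⁱ zero    f n = f n
Σⁱ (suc r) f n = sum1 (λ i → Σⁱ r f i) n

{-# OPTIONS --safe #-}
module Submission where

-- Fix x ∈ ℚ and write Pₙ for Pₙ(x). Pascal's rule applied twice gives
-- T_k(n+2) + T_k(n) = T_{k−1}(n+1) + 2 T_k(n+1) (with T₋₁ = 0), hence Pₙ₊₂ + Pₙ = (x + 2) Pₙ₊₁ with P₀ = 1, P₁ = x + 3,
-- i.e. Σ Pₙ tⁿ = (1 + t) / ((1 − t)² − x t). For the backward differences ∇ᵃ of the sequence P this reads
-- ∇ᵃ⁺²P(n+1) = x ∇ᵃP(n) + εₐ(n+1) with εₐ(k) = [tᵏ] (1 + t)(1 − t)ᵃ, proved by induction on a.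
-- By the symmetry C(2m+1, m+1) = C(2m+1, m) the boundary term ε₂ₘ₊₁(m+1) vanishes, so induction on m gives
-- xᵐ = ∇²ᵐ⁺¹P(m) = Σⱼ (−1)ʲ C(2m+1, j) Pₘ₋ⱼ(x) for every x. The theorem is this identity at x = q(k), summed
-- r times: Σʳ is linear, and no hypothesis on q or n is needed.

open import Defs

module _ where
  open import Data.Nat as ℕ using (ℕ; zero; suc; _∸_; _<_; s≤s)
  import Data.Nat.Properties as ℕP
  open import Data.Nat.Combinatorics
    using (_C_; k>n⇒nCk≡0; nCk+nC[k+1]≡[n+1]C[k+1]; nCk≡nC[n∸k]; nC1≡n)
  import Data.Nat.Tactic.RingSolver as ℕ-Solver
  open import Data.Integer as ℤ using () renaming (+_ to ⁺_)
  import Data.Integer.Properties as ℤP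
  open import Data.Nat.Coprimality as Coprime using (1-coprimeTo)
  open import Data.Rational using (ℚ; 0ℚ; 1ℚ; _+_; _*_; -_; _-_; _/_; mkℚ; _≟_)
  open import Data.Rational.Properties
    using ( +-*-commutativeRing; normalize-coprime; +-identityˡ; +-identityʳ; +-assoc
          ; *-zeroˡ; *-zeroʳ; *-identityˡ; *-assoc; *-distribˡ-+; *-distribʳ-+)
  open import Relation.Nullary.Decidable.Core using (dec⇒maybe)
  open import Relation.Binary.PropositionalEquality
  open import Tactic.RingSolver using (solve-∀)
  open import Tactic.RingSolver.Core.AlmostCommutativeRing
    using (AlmostCommutativeRing; fromCommutativeRing)
  open ≡-Reasoning

  ℚ-ring : AlmostCommutativeRing _ _
  ℚ-ring = fromCommutativeRing +-*-commutativeRing (λ x → dec⇒maybe (0ℚ ≟ x))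

  ℕ→ℚ-suc : ∀ n → ℕ→ℚ (suc n) ≡ 1ℚ + ℕ→ℚ n
  ℕ→ℚ-suc n = begin
    ⁺ suc n / 1                              ≡⟨ cong (λ i → (⁺ 1 ℤ.+ i) / 1) (sym (ℤP.*-identityʳ (⁺ n))) ⟩
    (⁺ 1 ℤ.* ⁺ 1 ℤ.+ ⁺ n ℤ.* ⁺ 1) / 1        ≡⟨⟩
    1ℚ + mkℚ (⁺ n) 0 coprime                 ≡⟨ cong (1ℚ +_) (sym (normalize-coprime coprime)) ⟩
    1ℚ + ℕ→ℚ n                               ∎
    where
    coprime : Coprime.Coprime n 1
    coprime = Coprime.sym (1-coprimeTo n)

  ℕ→ℚ-+ : ∀ m n → ℕ→ℚ (m ℕ.+ n) ≡ ℕ→ℚ m + ℕ→ℚ n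
  ℕ→ℚ-+ zero    n = sym (+-identityˡ (ℕ→ℚ n))
  ℕ→ℚ-+ (suc m) n = begin
    ℕ→ℚ (suc (m ℕ.+ n))    ≡⟨ ℕ→ℚ-suc (m ℕ.+ n) ⟩
    1ℚ + ℕ→ℚ (m ℕ.+ n)     ≡⟨ cong (1ℚ +_) (ℕ→ℚ-+ m n) ⟩
    1ℚ + (ℕ→ℚ m + ℕ→ℚ n)   ≡⟨ sym (+-assoc 1ℚ (ℕ→ℚ m) (ℕ→ℚ n)) ⟩
    (1ℚ + ℕ→ℚ m) + ℕ→ℚ n   ≡⟨ cong (_+ ℕ→ℚ n) (sym (ℕ→ℚ-suc m)) ⟩
    ℕ→ℚ (suc m) + ℕ→ℚ n    ∎

  ℕ→ℚ-* : ∀ m n → ℕ→ℚ (m ℕ.* n) ≡ ℕ→ℚ m * ℕ→ℚ n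
  ℕ→ℚ-* zero    n = sym (*-zeroˡ (ℕ→ℚ n))
  ℕ→ℚ-* (suc m) n = begin
    ℕ→ℚ (n ℕ.+ m ℕ.* n)     ≡⟨ ℕ→ℚ-+ n (m ℕ.* n) ⟩
    ℕ→ℚ n + ℕ→ℚ (m ℕ.* n)   ≡⟨ cong (ℕ→ℚ n +_) (ℕ→ℚ-* m n) ⟩
    ℕ→ℚ n + ℕ→ℚ m * ℕ→ℚ n   ≡⟨ distrib (ℕ→ℚ m) (ℕ→ℚ n) ⟩
    (1ℚ + ℕ→ℚ m) * ℕ→ℚ n    ≡⟨ cong (_* ℕ→ℚ n) (sym (ℕ→ℚ-suc m)) ⟩
    ℕ→ℚ (suc m) * ℕ→ℚ n     ∎
    where
    distrib : ∀ a b → b + a * b ≡ (1ℚ + a) * b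
    distrib = solve-∀ ℚ-ring

  sum0-cong : ∀ {f g : ℕ → ℚ} → (∀ k → f k ≡ g k) → ∀ n → sum0 f n ≡ sum0 g n
  sum0-cong f≡g zero    = f≡g 0
  sum0-cong f≡g (suc n) = cong₂ _+_ (sum0-cong f≡g n) (f≡g (suc n))

  sum0-head : ∀ (f : ℕ → ℚ) n → sum0 f (suc n) ≡ f 0 + sum0 (λ k → f (suc k)) n
  sum0-head f zero    = refl
  sum0-head f (suc n) = trans (cong (_+ f (2 ℕ.+ n)) (sum0-head f n)) (+-assoc (f 0) _ _)

  sum0-zero : ∀ n → sum0 (λ _ → 0ℚ) n ≡ 0ℚ
  sum0-zero zero    = refl
  sum0-zero (suc n) = cong (_+ 0ℚ) (sum0-zero n)

  sum0-+ : ∀ (f g : ℕ → ℚ) n → sum0 (λ k → f k + g k) n ≡ sum0 f n + sum0 g n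
  sum0-+ f g zero    = refl
  sum0-+ f g (suc n) = trans (cong (_+ (f (suc n) + g (suc n))) (sum0-+ f g n))
                             (interchange (sum0 f n) (sum0 g n) (f (suc n)) (g (suc n)))
    where
    interchange : ∀ a b c d → (a + b) + (c + d) ≡ (a + c) + (b + d)
    interchange = solve-∀ ℚ-ring

  sum0-- : ∀ (f g : ℕ → ℚ) n → sum0 (λ k → f k - g k) n ≡ sum0 f n - sum0 g n
  sum0-- f g zero    = refl
  sum0-- f g (suc n) = trans (cong (_+ (f (suc n) - g (suc n))) (sum0-- f g n))
                             (interchange (sum0 f n) (sum0 g n) (f (suc n)) (g (suc n)))
    where
    interchange : ∀ a b c d → (a - b) + (c - d) ≡ (a + c) - (b + d)
    interchange = solve-∀ ℚ-ring

  sum0-*ˡ : ∀ c (f : ℕ → ℚ) n → sum0 (λ k → c * f k) n ≡ c * sum0 f n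
  sum0-*ˡ c f zero    = refl
  sum0-*ˡ c f (suc n) = trans (cong (_+ c * f (suc n)) (sum0-*ˡ c f n)) (sym (*-distribˡ-+ c _ _))

  sum1-cong : ∀ {f g : ℕ → ℚ} → (∀ k → f k ≡ g k) → ∀ n → sum1 f n ≡ sum1 g n
  sum1-cong f≡g zero    = refl
  sum1-cong f≡g (suc n) = cong₂ _+_ (sum1-cong f≡g n) (f≡g (suc n))

  sum1-*ˡ : ∀ c (f : ℕ → ℚ) n → sum1 (λ k → c * f k) n ≡ c * sum1 f n
  sum1-*ˡ c f zero    = sym (*-zeroʳ c)
  sum1-*ˡ c f (suc n) = trans (cong (_+ c * f (suc n)) (sum1-*ˡ c f n)) (sym (*-distribˡ-+ c _ _))

  sum1-sum0 : ∀ (g : ℕ → ℕ → ℚ) m n →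
              sum1 (λ i → sum0 (λ j → g j i) m) n ≡ sum0 (λ j → sum1 (g j) n) m
  sum1-sum0 g m zero    = sym (sum0-zero m)
  sum1-sum0 g m (suc n) = begin
    sum1 (λ i → sum0 (λ j → g j i) m) n + sum0 (λ j → g j (suc n)) m
      ≡⟨ cong (_+ sum0 (λ j → g j (suc n)) m) (sum1-sum0 g m n) ⟩
    sum0 (λ j → sum1 (g j) n) m + sum0 (λ j → g j (suc n)) m
      ≡⟨ sym (sum0-+ _ _ m) ⟩
    sum0 (λ j → sum1 (g j) (suc n)) m
      ∎

  Σⁱ-cong : ∀ {f g : ℕ → ℚ} → (∀ k → f k ≡ g k) → ∀ r n → Σⁱ r f n ≡ Σⁱ r g n
  Σⁱ-cong f≡g zero    n = f≡g n
  Σⁱ-cong f≡g (suc r) n = sum1-cong (Σⁱ-cong f≡g r) n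

  Σⁱ-*ˡ : ∀ c (f : ℕ → ℚ) r n → Σⁱ r (λ k → c * f k) n ≡ c * Σⁱ r f n
  Σⁱ-*ˡ c f zero    n = refl
  Σⁱ-*ˡ c f (suc r) n = trans (sum1-cong (Σⁱ-*ˡ c f r) n) (sum1-*ˡ c (Σⁱ r f) n)

  Σⁱ-sum0 : ∀ (g : ℕ → ℕ → ℚ) m r n →
            Σⁱ r (λ k → sum0 (λ j → g j k) m) n ≡ sum0 (λ j → Σⁱ r (g j) n) m
  Σⁱ-sum0 g m zero    n = refl
  Σⁱ-sum0 g m (suc r) n = trans (sum1-cong (Σⁱ-sum0 g m r) n) (sum1-sum0 (λ j → Σⁱ r (g j)) m n)

  [n+2]C[k+2]+nC[k+2]≡nCk+2*[n+1]C[k+2] : ∀ n k →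
    suc (suc n) C suc (suc k) ℕ.+ n C suc (suc k) ≡ n C k ℕ.+ 2 ℕ.* (suc n C suc (suc k))
  [n+2]C[k+2]+nC[k+2]≡nCk+2*[n+1]C[k+2] n k
    rewrite sym (nCk+nC[k+1]≡[n+1]C[k+1] (suc n) (suc k))
          | sym (nCk+nC[k+1]≡[n+1]C[k+1] n k)
          | sym (nCk+nC[k+1]≡[n+1]C[k+1] n (suc k))
    = regroup (n C k) (n C suc k) (n C suc (suc k))
    where
    regroup : ∀ a b c → a ℕ.+ b ℕ.+ (b ℕ.+ c) ℕ.+ c ≡ a ℕ.+ 2 ℕ.* (b ℕ.+ c)
    regroup = ℕ-Solver.solve-∀

  [m+n]Cm≡[m+n]Cn : ∀ m n → (m ℕ.+ n) C m ≡ (m ℕ.+ n) C n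
  [m+n]Cm≡[m+n]Cn m n = trans (nCk≡nC[n∸k] (ℕP.m≤m+n m n)) (cong ((m ℕ.+ n) C_) (ℕP.m+n∸m≡n m n))

  adjC : ℕ → ℕ → ℕ
  adjC n k = suc n C k ℕ.+ n C k

  adjC-rec : ∀ n k → adjC (suc (suc n)) (suc (suc k)) ℕ.+ adjC n (suc (suc k))
                     ≡ adjC n k ℕ.+ 2 ℕ.* adjC (suc n) (suc (suc k))
  adjC-rec n k = begin
    (a₃ ℕ.+ a₂) ℕ.+ (a₁ ℕ.+ a₀)                             ≡⟨ interchange a₃ a₂ a₁ a₀ ⟩
    (a₃ ℕ.+ a₁) ℕ.+ (a₂ ℕ.+ a₀)                             ≡⟨ cong₂ ℕ._+_ ([n+2]C[k+2]+nC[k+2]≡nCk+2*[n+1]C[k+2] (suc n) k)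
                                                                            ([n+2]C[k+2]+nC[k+2]≡nCk+2*[n+1]C[k+2] n k) ⟩
    (suc n C k ℕ.+ 2 ℕ.* a₂) ℕ.+ (n C k ℕ.+ 2 ℕ.* a₁)       ≡⟨ regroup (suc n C k) (n C k) a₂ a₁ ⟩
    adjC n k ℕ.+ 2 ℕ.* adjC (suc n) (suc (suc k))          ∎
    where
    a₀ a₁ a₂ a₃ : ℕ
    a₀ = n C suc (suc k)
    a₁ = suc n C suc (suc k)
    a₂ = suc (suc n) C suc (suc k)
    a₃ = suc (suc (suc n)) C suc (suc k)
    interchange : ∀ a b c d → (a ℕ.+ b) ℕ.+ (c ℕ.+ d) ≡ (a ℕ.+ c) ℕ.+ (b ℕ.+ d)
    interchange = ℕ-Solver.solve-∀
    regroup : ∀ a b c d → (a ℕ.+ 2 ℕ.* c) ℕ.+ (b ℕ.+ 2 ℕ.* d) ≡ (a ℕ.+ b) ℕ.+ 2 ℕ.* (c ℕ.+ d)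
    regroup = ℕ-Solver.solve-∀

  T-adjC : ∀ k n → T k n ≡ adjC (n ℕ.+ k) (2 ℕ.* k ℕ.+ 1)
  T-adjC k n = cong (λ m → m C (2 ℕ.* k ℕ.+ 1) ℕ.+ (n ℕ.+ k) C (2 ℕ.* k ℕ.+ 1)) (ℕP.+-comm (n ℕ.+ k) 1)

  T-suc-adjC : ∀ k n → T (suc k) n ≡ adjC (suc (n ℕ.+ k)) (suc (suc (2 ℕ.* k ℕ.+ 1)))
  T-suc-adjC k n = trans (T-adjC (suc k) n) (cong₂ adjC (ℕP.+-suc n k) (index k))
    where
    index : ∀ k → 2 ℕ.* suc k ℕ.+ 1 ≡ suc (suc (2 ℕ.* k ℕ.+ 1))
    index = ℕ-Solver.solve-∀

  T-zero : ∀ n → T 0 n ≡ 2 ℕ.* n ℕ.+ 1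
  T-zero n = trans (cong₂ ℕ._+_ (nC1≡n (n ℕ.+ 0 ℕ.+ 1)) (nC1≡n (n ℕ.+ 0))) (arith n)
    where
    arith : ∀ n → n ℕ.+ 0 ℕ.+ 1 ℕ.+ (n ℕ.+ 0) ≡ 2 ℕ.* n ℕ.+ 1
    arith = ℕ-Solver.solve-∀

  T-zero-rec : ∀ n → T 0 (suc (suc n)) ℕ.+ T 0 n ≡ 0 ℕ.+ 2 ℕ.* T 0 (suc n)
  T-zero-rec n
    rewrite T-zero (suc (suc n)) | T-zero n | T-zero (suc n) = arith n
    where
    arith : ∀ n → 2 ℕ.* suc (suc n) ℕ.+ 1 ℕ.+ (2 ℕ.* n ℕ.+ 1) ≡ 0 ℕ.+ 2 ℕ.* (2 ℕ.* suc n ℕ.+ 1)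
    arith = ℕ-Solver.solve-∀

  T-suc-rec : ∀ k n → T (suc k) (suc (suc n)) ℕ.+ T (suc k) n ≡ T k (suc n) ℕ.+ 2 ℕ.* T (suc k) (suc n)
  T-suc-rec k n = begin
    T (suc k) (suc (suc n)) ℕ.+ T (suc k) n
      ≡⟨ cong₂ ℕ._+_ (T-suc-adjC k (suc (suc n))) (T-suc-adjC k n) ⟩
    adjC (suc (suc m)) (suc (suc a)) ℕ.+ adjC m (suc (suc a))
      ≡⟨ adjC-rec m a ⟩
    adjC m a ℕ.+ 2 ℕ.* adjC (suc m) (suc (suc a))
      ≡⟨ sym (cong₂ (λ u v → u ℕ.+ 2 ℕ.* v) (T-adjC k (suc n)) (T-suc-adjC k (suc n))) ⟩
    T k (suc n) ℕ.+ 2 ℕ.* T (suc k) (suc n)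
      ∎
    where
    m a : ℕ
    m = suc (n ℕ.+ k)
    a = 2 ℕ.* k ℕ.+ 1

  T-vanish : ∀ {k n} → n < k → T k n ≡ 0
  T-vanish {k} {n} n<k =
    cong₂ ℕ._+_ (k>n⇒nCk≡0 n+k+1<2k+1) (k>n⇒nCk≡0 (ℕP.<-trans (ℕP.m<m+n (n ℕ.+ k) ℕP.0<1+n) n+k+1<2k+1))
    where
    n+k+1<2k+1 : n ℕ.+ k ℕ.+ 1 < 2 ℕ.* k ℕ.+ 1
    n+k+1<2k+1 = ℕP.+-monoˡ-< 1 (subst (n ℕ.+ k <_) (cong (k ℕ.+_) (sym (ℕP.+-identityʳ k))) (ℕP.+-monoˡ-< k n<k))

  shift : (ℕ → ℚ) → ℕ → ℚ
  shift c zero    = 0ℚ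
  shift c (suc k) = c k

  *-sum0-shift : ∀ x (c : ℕ → ℚ) n →
                 x * sum0 (λ k → c k * x ^ℚ k) n ≡ sum0 (λ k → shift c k * x ^ℚ k) (suc n)
  *-sum0-shift x c zero    = reorder (c 0) x
    where
    reorder : ∀ a y → y * (a * 1ℚ) ≡ 0ℚ * 1ℚ + a * (y * 1ℚ)
    reorder = solve-∀ ℚ-ring
  *-sum0-shift x c (suc n) =
    trans (*-distribˡ-+ x _ _) (cong₂ _+_ (*-sum0-shift x c n) (reorder (c (suc n)) x (x ^ℚ suc n)))
    where
    reorder : ∀ a y z → y * (a * z) ≡ a * (y * z)
    reorder = solve-∀ ℚ-ring

  P-pad : ∀ x d n → sum0 (λ k → ℕ→ℚ (T k n) * x ^ℚ k) (d ℕ.+ n) ≡ P n x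
  P-pad x zero    n = refl
  P-pad x (suc d) n = begin
    sum0 (λ k → ℕ→ℚ (T k n) * x ^ℚ k) (d ℕ.+ n) + ℕ→ℚ (T (suc d ℕ.+ n) n) * x ^ℚ suc (d ℕ.+ n)
      ≡⟨ cong₂ _+_ (P-pad x d n) (cong (λ t → ℕ→ℚ t * x ^ℚ suc (d ℕ.+ n)) (T-vanish (s≤s (ℕP.m≤n+m n d)))) ⟩
    P n x + 0ℚ * x ^ℚ suc (d ℕ.+ n)
      ≡⟨ cong (P n x +_) (*-zeroˡ (x ^ℚ suc (d ℕ.+ n))) ⟩
    P n x + 0ℚ
      ≡⟨ +-identityʳ (P n x) ⟩
    P n x
      ∎

  ℕ→ℚ-+≡+2* : ∀ a b c d → a ℕ.+ b ≡ c ℕ.+ 2 ℕ.* d → ℕ→ℚ a + ℕ→ℚ b ≡ ℕ→ℚ c + ℕ→ℚ 2 * ℕ→ℚ d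
  ℕ→ℚ-+≡+2* a b c d eq = begin
    ℕ→ℚ a + ℕ→ℚ b           ≡⟨ sym (ℕ→ℚ-+ a b) ⟩
    ℕ→ℚ (a ℕ.+ b)           ≡⟨ cong ℕ→ℚ eq ⟩
    ℕ→ℚ (c ℕ.+ 2 ℕ.* d)     ≡⟨ ℕ→ℚ-+ c (2 ℕ.* d) ⟩
    ℕ→ℚ c + ℕ→ℚ (2 ℕ.* d)   ≡⟨ cong (ℕ→ℚ c +_) (ℕ→ℚ-* 2 d) ⟩
    ℕ→ℚ c + ℕ→ℚ 2 * ℕ→ℚ d   ∎

  T-rec : ∀ n k → ℕ→ℚ (T k (suc (suc n))) + ℕ→ℚ (T k n)
                  ≡ shift (λ j → ℕ→ℚ (T j (suc n))) k + ℕ→ℚ 2 * ℕ→ℚ (T k (suc n))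
  T-rec n zero    = ℕ→ℚ-+≡+2* (T 0 (suc (suc n))) (T 0 n) 0 (T 0 (suc n)) (T-zero-rec n)
  T-rec n (suc k) = ℕ→ℚ-+≡+2* (T (suc k) (suc (suc n))) (T (suc k) n) (T k (suc n)) (T (suc k) (suc n))
                               (T-suc-rec k n)

  P-rec : ∀ x n → P (suc (suc n)) x + P n x ≡ (x + ℕ→ℚ 2) * P (suc n) x
  P-rec x n = begin
    P (suc (suc n)) x + P n x
      ≡⟨ cong (P (suc (suc n)) x +_) (sym (P-pad x 2 n)) ⟩
    sum0 (t (suc (suc n))) L + sum0 (t n) L
      ≡⟨ sym (sum0-+ (t (suc (suc n))) (t n) L) ⟩
    sum0 (λ k → t (suc (suc n)) k + t n k) L
      ≡⟨ sum0-cong termwise L ⟩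
    sum0 (λ k → shift c k * x ^ℚ k + two * t (suc n) k) L
      ≡⟨ sum0-+ _ _ L ⟩
    sum0 (λ k → shift c k * x ^ℚ k) L + sum0 (λ k → two * t (suc n) k) L
      ≡⟨ cong₂ _+_ (sym (*-sum0-shift x c (suc n))) (sum0-*ˡ two (t (suc n)) L) ⟩
    x * P (suc n) x + two * sum0 (t (suc n)) L
      ≡⟨ cong (λ s → x * P (suc n) x + two * s) (P-pad x 1 (suc n)) ⟩
    x * P (suc n) x + two * P (suc n) x
      ≡⟨ sym (*-distribʳ-+ (P (suc n) x) x two) ⟩
    (x + two) * P (suc n) x
      ∎
    where
    L : ℕ
    L = suc (suc n)
    two : ℚ
    two = ℕ→ℚ 2
    t : ℕ → ℕ → ℚ
    t i k = ℕ→ℚ (T k i) * x ^ℚ k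
    c : ℕ → ℚ
    c j = ℕ→ℚ (T j (suc n))
    termwise : ∀ k → t (suc (suc n)) k + t n k ≡ shift c k * x ^ℚ k + two * t (suc n) k
    termwise k = begin
      ℕ→ℚ (T k (suc (suc n))) * y + ℕ→ℚ (T k n) * y  ≡⟨ sym (*-distribʳ-+ y (ℕ→ℚ (T k (suc (suc n)))) (ℕ→ℚ (T k n))) ⟩
      (ℕ→ℚ (T k (suc (suc n))) + ℕ→ℚ (T k n)) * y    ≡⟨ cong (_* y) (T-rec n k) ⟩
      (shift c k + two * ℕ→ℚ (T k (suc n))) * y       ≡⟨ *-distribʳ-+ y (shift c k) (two * ℕ→ℚ (T k (suc n))) ⟩
      shift c k * y + (two * ℕ→ℚ (T k (suc n))) * y   ≡⟨ cong (shift c k * y +_) (*-assoc two (ℕ→ℚ (T k (suc n))) y) ⟩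
      shift c k * y + two * t (suc n) k                ∎
      where
      y : ℚ
      y = x ^ℚ k

  altC : ℕ → ℕ → ℚ
  altC a j = sgn j * ℕ→ℚ (a C j)

  altC-suc : ∀ a j → altC (suc a) (suc j) ≡ altC a (suc j) - altC a j
  altC-suc a j = begin
    - sgn j * ℕ→ℚ (suc a C suc j)               ≡⟨ cong (λ c → - sgn j * c) pascal ⟩
    - sgn j * (ℕ→ℚ (a C j) + ℕ→ℚ (a C suc j))   ≡⟨ distrib (sgn j) (ℕ→ℚ (a C j)) (ℕ→ℚ (a C suc j)) ⟩
    - sgn j * ℕ→ℚ (a C suc j) - sgn j * ℕ→ℚ (a C j) ∎
    where
    pascal : ℕ→ℚ (suc a C suc j) ≡ ℕ→ℚ (a C j) + ℕ→ℚ (a C suc j)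
    pascal = trans (cong ℕ→ℚ (sym (nCk+nC[k+1]≡[n+1]C[k+1] a j))) (ℕ→ℚ-+ (a C j) (a C suc j))
    distrib : ∀ s u v → - s * (u + v) ≡ - s * v - s * u
    distrib = solve-∀ ℚ-ring

  altC-zero-suc : ∀ j → altC 0 (suc j) ≡ 0ℚ
  altC-zero-suc j = *-zeroʳ (sgn (suc j))

  -- ∇ a p is the a-th backward difference of p, where p is extended by 0 to negative arguments.
  ∇ : ℕ → (ℕ → ℚ) → ℕ → ℚ
  ∇ a p n = sum0 (λ j → altC a j * p (n ∸ j)) n

  ∇-zero : ∀ p n → ∇ 0 p n ≡ p n
  ∇-zero p zero    = *-identityˡ (p 0)
  ∇-zero p (suc n) = begin
    ∇ 0 p (suc n)                                             ≡⟨ sum0-head _ n ⟩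
    1ℚ * p (suc n) + sum0 (λ j → altC 0 (suc j) * p (n ∸ j)) n  ≡⟨ cong₂ _+_ (*-identityˡ (p (suc n))) tail≡0 ⟩
    p (suc n) + 0ℚ                                            ≡⟨ +-identityʳ (p (suc n)) ⟩
    p (suc n)                                                 ∎
    where
    tail≡0 : sum0 (λ j → altC 0 (suc j) * p (n ∸ j)) n ≡ 0ℚ
    tail≡0 = trans (sum0-cong (λ j → trans (cong (_* p (n ∸ j)) (altC-zero-suc j)) (*-zeroˡ (p (n ∸ j)))) n)
                   (sum0-zero n)

  ∇-suc : ∀ a p n → ∇ (suc a) p (suc n) ≡ ∇ a p (suc n) - ∇ a p n
  ∇-suc a p n = begin
    ∇ (suc a) p (suc n)                            ≡⟨ sum0-head _ n ⟩
    head + sum0 (λ j → altC (suc a) (suc j) * p (n ∸ j)) n  ≡⟨ cong (head +_) (sum0-cong termwise n) ⟩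
    head + sum0 (λ j → A j - B j) n                ≡⟨ cong (head +_) (sum0-- A B n) ⟩
    head + (sum0 A n - sum0 B n)                   ≡⟨ sym (+-assoc head (sum0 A n) (- sum0 B n)) ⟩
    (head + sum0 A n) - sum0 B n                   ≡⟨ cong (_- sum0 B n) (sym (sum0-head _ n)) ⟩
    ∇ a p (suc n) - ∇ a p n                        ∎
    where
    head : ℚ
    head = altC a 0 * p (suc n)
    A B : ℕ → ℚ
    A j = altC a (suc j) * p (n ∸ j)
    B j = altC a j * p (n ∸ j)
    distrib : ∀ u v w → (u - v) * w ≡ u * w - v * w
    distrib = solve-∀ ℚ-ring
    termwise : ∀ j → altC (suc a) (suc j) * p (n ∸ j) ≡ A j - B j
    termwise j = trans (cong (_* p (n ∸ j)) (altC-suc a j)) (distrib (altC a (suc j)) (altC a j) (p (n ∸ j)))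

  ∇-one : ∀ p n → ∇ 1 p (suc n) ≡ p (suc n) - p n
  ∇-one p n = trans (∇-suc 0 p n) (cong₂ _-_ (∇-zero p (suc n)) (∇-zero p n))

  ∇-two : ∀ p n → ∇ 2 p (suc (suc n)) ≡ (p (suc (suc n)) + p n) - ℕ→ℚ 2 * p (suc n)
  ∇-two p n = begin
    ∇ 2 p (suc (suc n))                                 ≡⟨ ∇-suc 1 p (suc n) ⟩
    ∇ 1 p (suc (suc n)) - ∇ 1 p (suc n)                 ≡⟨ cong₂ _-_ (∇-one p (suc n)) (∇-one p n) ⟩
    (p (suc (suc n)) - p (suc n)) - (p (suc n) - p n)   ≡⟨ regroup (p (suc (suc n))) (p (suc n)) (p n) ⟩
    (p (suc (suc n)) + p n) - ℕ→ℚ 2 * p (suc n)          ∎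
    where
    regroup : ∀ u v w → (u - v) - (v - w) ≡ (u + w) - (1ℚ + 1ℚ) * v
    regroup = solve-∀ ℚ-ring

  -- ε a k is the coefficient of tᵏ in (1 + t)(1 − t)ᵃ, that is, ∇ a applied to the sequence 1, 1, 0, 0, …
  ε : ℕ → ℕ → ℚ
  ε a zero    = 1ℚ
  ε a (suc k) = altC a (suc k) + altC a k

  ε-suc : ∀ a k → ε (suc a) (suc k) ≡ ε a (suc k) - ε a k
  ε-suc a zero    = trans (cong (_+ 1ℚ) (altC-suc a 0)) (regroup (altC a 1) (altC a 0))
    where
    regroup : ∀ u v → (u - v) + v ≡ (u + v) - v
    regroup = solve-∀ ℚ-ring
  ε-suc a (suc k) = trans (cong₂ _+_ (altC-suc a (suc k)) (altC-suc a k))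
                          (regroup (altC a (suc (suc k))) (altC a (suc k)) (altC a k))
    where
    regroup : ∀ u v w → (u - v) + (v - w) ≡ (u + v) - (v + w)
    regroup = solve-∀ ℚ-ring

  ε-vanish : ∀ m → ε (2 ℕ.* m ℕ.+ 1) (suc m) ≡ 0ℚ
  ε-vanish m = begin
    - sgn m * ℕ→ℚ (N C suc m) + sgn m * ℕ→ℚ (N C m)  ≡⟨ cong (λ c → - sgn m * ℕ→ℚ c + sgn m * ℕ→ℚ (N C m)) symmetric ⟩
    - sgn m * ℕ→ℚ (N C m) + sgn m * ℕ→ℚ (N C m)      ≡⟨ cancel (sgn m) (ℕ→ℚ (N C m)) ⟩
    0ℚ                                               ∎
    where
    N : ℕ
    N = 2 ℕ.* m ℕ.+ 1
    N≡[m+1]+m : ∀ m → 2 ℕ.* m ℕ.+ 1 ≡ suc m ℕ.+ m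
    N≡[m+1]+m = ℕ-Solver.solve-∀
    symmetric : N C suc m ≡ N C m
    symmetric = subst (λ n → n C suc m ≡ n C m) (sym (N≡[m+1]+m m)) ([m+n]Cm≡[m+n]Cn (suc m) m)
    cancel : ∀ s c → - s * c + s * c ≡ 0ℚ
    cancel = solve-∀ ℚ-ring

  P-one : ∀ x → P 1 x ≡ x + ℕ→ℚ 3
  P-one = normal-form
    where
    -- the unfolding of P 1 x, which the solver cannot see through
    normal-form : ∀ x → ℕ→ℚ 3 * 1ℚ + 1ℚ * (x * 1ℚ) ≡ x + ℕ→ℚ 3
    normal-form = solve-∀ ℚ-ring

  module _ (x : ℚ) where
    Pₓ : ℕ → ℚ
    Pₓ k = P k x

    -- At index 0 everything (P₀(x), ∇ a Pₓ 0, ε a 0) reduces to 1ℚ; the n = 0 cases rely on this.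
    ∇-step : ∀ a n → ∇ (suc (suc a)) Pₓ (suc n) ≡ x * ∇ a Pₓ n + ε a (suc n)
    ∇-step zero zero = begin
      ∇ 2 Pₓ 1                      ≡⟨ ∇-suc 1 Pₓ 0 ⟩
      ∇ 1 Pₓ 1 - ∇ 1 Pₓ 0           ≡⟨ cong (_- 1ℚ) (trans (∇-one Pₓ 0) (cong (_- 1ℚ) (P-one x))) ⟩
      ((x + ℕ→ℚ 3) - 1ℚ) - 1ℚ       ≡⟨ simplify x ⟩
      x * 1ℚ + 1ℚ                   ∎
      where
      simplify : ∀ x → ((x + ℕ→ℚ 3) - 1ℚ) - 1ℚ ≡ x * 1ℚ + 1ℚ
      simplify = solve-∀ ℚ-ring
    ∇-step zero (suc n) = begin
      ∇ 2 Pₓ (suc (suc n))                            ≡⟨ ∇-two Pₓ n ⟩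
      (Pₓ (suc (suc n)) + Pₓ n) - ℕ→ℚ 2 * Pₓ (suc n)  ≡⟨ cong (_- ℕ→ℚ 2 * Pₓ (suc n)) (P-rec x n) ⟩
      (x + ℕ→ℚ 2) * Pₓ (suc n) - ℕ→ℚ 2 * Pₓ (suc n)   ≡⟨ simplify x (Pₓ (suc n)) ⟩
      x * Pₓ (suc n) + 0ℚ                             ≡⟨ cong₂ (λ s e → x * s + e) (sym (∇-zero Pₓ (suc n))) ε≡0 ⟩
      x * ∇ 0 Pₓ (suc n) + ε 0 (suc (suc n))         ∎
      where
      simplify : ∀ x u → (x + (1ℚ + 1ℚ)) * u - (1ℚ + 1ℚ) * u ≡ x * u + 0ℚ
      simplify = solve-∀ ℚ-ring
      ε≡0 : 0ℚ ≡ ε 0 (suc (suc n))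
      ε≡0 = sym (cong₂ _+_ (altC-zero-suc (suc n)) (altC-zero-suc n))
    ∇-step (suc a) zero = begin
      ∇ (3 ℕ.+ a) Pₓ 1                            ≡⟨ ∇-suc (2 ℕ.+ a) Pₓ 0 ⟩
      ∇ (2 ℕ.+ a) Pₓ 1 - ∇ (2 ℕ.+ a) Pₓ 0         ≡⟨ cong (_- 1ℚ) (∇-step a 0) ⟩
      (x * ∇ a Pₓ 0 + ε a 1) - ε a 0              ≡⟨ +-assoc (x * 1ℚ) (ε a 1) (- 1ℚ) ⟩
      x * ∇ a Pₓ 0 + (ε a 1 - ε a 0)              ≡⟨ cong (x * 1ℚ +_) (sym (ε-suc a 0)) ⟩
      x * ∇ (suc a) Pₓ 0 + ε (suc a) 1            ∎
    ∇-step (suc a) (suc n) = begin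
      ∇ (3 ℕ.+ a) Pₓ (suc (suc n))
        ≡⟨ ∇-suc (2 ℕ.+ a) Pₓ (suc n) ⟩
      ∇ (2 ℕ.+ a) Pₓ (suc (suc n)) - ∇ (2 ℕ.+ a) Pₓ (suc n)
        ≡⟨ cong₂ _-_ (∇-step a (suc n)) (∇-step a n) ⟩
      (x * ∇ a Pₓ (suc n) + ε a (suc (suc n))) - (x * ∇ a Pₓ n + ε a (suc n))
        ≡⟨ regroup x (∇ a Pₓ (suc n)) (∇ a Pₓ n) (ε a (suc (suc n))) (ε a (suc n)) ⟩
      x * (∇ a Pₓ (suc n) - ∇ a Pₓ n) + (ε a (suc (suc n)) - ε a (suc n))
        ≡⟨ cong₂ (λ s e → x * s + e) (sym (∇-suc a Pₓ n)) (sym (ε-suc a (suc n))) ⟩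
      x * ∇ (suc a) Pₓ (suc n) + ε (suc a) (suc (suc n))
        ∎
      where
      regroup : ∀ x s₁ s₀ e₁ e₀ → (x * s₁ + e₁) - (x * s₀ + e₀) ≡ x * (s₁ - s₀) + (e₁ - e₀)
      regroup = solve-∀ ℚ-ring

    ^ℚ-as-∇ : ∀ m → x ^ℚ m ≡ ∇ (2 ℕ.* m ℕ.+ 1) Pₓ m
    ^ℚ-as-∇ zero    = refl
    ^ℚ-as-∇ (suc m) = begin
      x * x ^ℚ m                                  ≡⟨ cong (x *_) (^ℚ-as-∇ m) ⟩
      x * ∇ N Pₓ m                                ≡⟨ sym (+-identityʳ (x * ∇ N Pₓ m)) ⟩
      x * ∇ N Pₓ m + 0ℚ                           ≡⟨ cong (x * ∇ N Pₓ m +_) (sym (ε-vanish m)) ⟩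
      x * ∇ N Pₓ m + ε N (suc m)                  ≡⟨ sym (∇-step N m) ⟩
      ∇ (suc (suc N)) Pₓ (suc m)                  ≡⟨ cong (λ a → ∇ a Pₓ (suc m)) (index m) ⟩
      ∇ (2 ℕ.* suc m ℕ.+ 1) Pₓ (suc m)            ∎
      where
      N : ℕ
      N = 2 ℕ.* m ℕ.+ 1
      index : ∀ m → suc (suc (2 ℕ.* m ℕ.+ 1)) ≡ 2 ℕ.* suc m ℕ.+ 1
      index = ℕ-Solver.solve-∀

  ^ℚ-expansion : ∀ x m → x ^ℚ m ≡ sum0 (λ j → sgn j * (ℕ→ℚ ((2 ℕ.* m ℕ.+ 1) C j) * P (m ∸ j) x)) m
  ^ℚ-expansion x m = trans (^ℚ-as-∇ x m) (sum0-cong (λ j → *-assoc (sgn j) _ (P (m ∸ j) x)) m)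

open import Data.Nat using (ℕ; _∸_; _≤_; _+_; _*_)
open import Data.Nat.Combinatorics using (_C_)
open import Data.Rational using (ℚ)
import Data.Rational as Q
open import Relation.Binary.PropositionalEquality using (_≡_; cong; trans; module ≡-Reasoning)
open ≡-Reasoning

theorem1 : (q : Poly) (d : ℕ) → HasDegree q d → 1 ≤ d →
           (m r n : ℕ) → 1 ≤ n →
           Σⁱ r (λ k → eval q (ℕ→ℚ k) ^ℚ m) n
             ≡ sum0 (λ j → sgn j Q.* (ℕ→ℚ ((2 * m + 1) C j) Q.* Σⁱ r (λ k → P (m ∸ j) (eval q (ℕ→ℚ k))) n)) m
theorem1 q _ _ _ m r n _ = begin
  Σⁱ r (λ k → eval q (ℕ→ℚ k) ^ℚ m) n
    ≡⟨ Σⁱ-cong (λ k → ^ℚ-expansion (eval q (ℕ→ℚ k)) m) r n ⟩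
  Σⁱ r (λ k → sum0 (λ j → sgn j Q.* (b j Q.* p j k)) m) n
    ≡⟨ Σⁱ-sum0 (λ j k → sgn j Q.* (b j Q.* p j k)) m r n ⟩
  sum0 (λ j → Σⁱ r (λ k → sgn j Q.* (b j Q.* p j k)) n) m
    ≡⟨ sum0-cong (λ j → trans (Σⁱ-*ˡ (sgn j) _ r n) (cong (sgn j Q.*_) (Σⁱ-*ˡ (b j) (p j) r n))) m ⟩
  sum0 (λ j → sgn j Q.* (b j Q.* Σⁱ r (p j) n)) m
    ∎
  where
  b : ℕ → ℚ
  b j = ℕ→ℚ ((2 * m + 1) C j)
  p : ℕ → ℕ → ℚ
  p j k = P (m ∸ j) (eval q (ℕ→ℚ k))
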